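{- Let $T$ be a tree of height $h$ with root $x$. For each $v\in V(T)$, let $T_v$ be the subtree of $T$ rooted at $v$. Let $b$ be a positive integer and let $S$ be a set of at least $bh+1$ vertices of $T$. Then there exists a vertex $y$ at distance $i$ from $x$, for some $0\leq i\leq h-1$, such that $|V(T_y)\cap S|\geq |S|-ib$ and such that for every child $z$ of $y$ in $T$, $|V(T_z)\cap S|\leq |V(T_y)\cap S|-b$.
   Context: The height of a rooted tree is the maximum distance from the root to a vertex. The subtree $T_v$ rooted at $v$ consists of $v$ and all its descendants. -}

module Defs where

open import Data.Bool using (Bool; true; false)
open import Data.Nat using (ℕ; zero; suc; _+_; _⊔_)
open import Data.List using (List; []; _∷_)
open import Data.List.Membership.Propositional using (_∈_)

-- A finite rooted tree whose vertices are marked: the Bool at a node says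
-- whether that vertex belongs to the set S.
data Tree : Set where
  node : Bool → List Tree → Tree

children : Tree → List Tree
children (node _ ts) = ts

mutual
  count : Tree → ℕ
  count (node true  ts) = suc (countList ts)
  count (node false ts) = countList ts

  countList : List Tree → ℕ
  countList []       = 0
  countList (t ∷ ts) = count t + countList ts

mutual
  height : Tree → ℕ
  height (node _ ts) = heightList ts

  heightList : List Tree → ℕ
  heightList []       = 0
  heightList (t ∷ ts) = suc (height t) ⊔ heightList ts

-- Desc i T y : y is (the subtree T_y rooted at) a vertex of T at distance i
-- from the root of T.
data Desc : ℕ → Tree → Tree → Set where
  here  : ∀ {t} → Desc 0 t t
  there : ∀ {i b ts s u} → s ∈ ts → Desc i s u → Desc (suc i) (node b ts) u

module Submission where

-- Proof idea: a greedy descent from the root.  Call a vertex y *dense* if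
-- |T_y ∩ S| ≥ b·height(T_y) + 1 (the root is dense by hypothesis) and
-- *b-balanced* if every child z satisfies |T_z ∩ S| + b ≤ |T_y ∩ S|.
-- Starting at a dense vertex y, either y is b-balanced and we stop, or some
-- child z is heavy: |T_y ∩ S| < |T_z ∩ S| + b.  A heavy child of a dense
-- vertex is again dense, and even satisfies |T_z ∩ S| ≥ b·height(T_z) + 2,
-- so it is not a leaf; descending into it therefore loses fewer than b
-- marked vertices per level and never reaches the deepest level h.

open import Defs
open import Data.Bool using (true; false)
open import Data.Nat using (ℕ; zero; suc; _+_; _*_; _∸_; _≤_; _≥_; _<_; z≤n; s≤s; _≤?_)
open import Data.Nat.Properties
open import Data.Product using (Σ; _×_; _,_; ∃-syntax)
open import Data.Sum using (_⊎_; inj₁; inj₂)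
open import Data.Empty using (⊥-elim)
open import Data.List using ([]; _∷_)
open import Data.List.Relation.Unary.Any using (here; there)
open import Data.List.Relation.Unary.All using (all?; lookup)
open import Data.List.Relation.Unary.All.Properties using (¬All⇒Any¬)
open import Data.List.Membership.Propositional using (_∈_; find)
open import Relation.Nullary using (yes; no)
open import Relation.Binary.PropositionalEquality using (refl; sym; cong)

child-height : ∀ {z ts} → z ∈ ts → height z < heightList ts
child-height {z} {_ ∷ ts} (here refl) = m≤m⊔n (suc (height z)) (heightList ts)
child-height {z} {t ∷ ts} (there z∈ts) =
  ≤-trans (child-height z∈ts) (m≤n⊔m (suc (height t)) (heightList ts))

two-marked⇒positive-height : ∀ t → 2 ≤ count t → 1 ≤ height t
two-marked⇒positive-height (node true  []) (s≤s ())
two-marked⇒positive-height (node false []) ()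
two-marked⇒positive-height (node m (t ∷ ts)) _ =
  ≤-trans (s≤s z≤n) (m≤m⊔n (suc (height t)) (heightList ts))

module _ (b : ℕ) where

  Dense : Tree → Set
  Dense y = b * height y + 1 ≤ count y

  Balanced : Tree → Set
  Balanced y = ∀ z → z ∈ children y → count z + b ≤ count y

  Witness : Tree → Set
  Witness y = Σ ℕ λ i → Σ Tree λ w → i ≤ height y ∸ 1 × Desc i y w ×
    (count y ≤ count w + i * b) × Balanced w

  balanced-or-heavy : ∀ y → Balanced y ⊎ ∃[ z ] (z ∈ children y × count y < count z + b)
  balanced-or-heavy y with all? (λ z → count z + b ≤? count y) (children y)
  ... | yes all-light = inj₁ (λ z z∈ → lookup all-light z∈)
  ... | no ¬all-light with find (¬All⇒Any¬ (λ z → count z + b ≤? count y) (children y) ¬all-light)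
  ...   | z , z∈ , not-light = inj₂ (z , z∈ , ≰⇒> not-light)

  -- A heavy child z of a dense vertex y has b·height z + 2 marked vertices:
  -- b·(height z + 1) + 1 ≤ b·height y + 1 ≤ count y < count z + b.
  heavy-child-count : ∀ {m ts z} → z ∈ ts → Dense (node m ts) →
    count (node m ts) < count z + b → b * height z + 2 ≤ count z
  heavy-child-count {m} {ts} {z} z∈ dense heavy =
    +-cancelˡ-≤ b (b * height z + 2) (count z) (begin
      b + (b * height z + 2)   ≡⟨ sym (+-assoc b (b * height z) 2) ⟩
      b + b * height z + 2     ≡⟨ cong (_+ 2) (sym (*-suc b (height z))) ⟩
      b * suc (height z) + 2   ≤⟨ +-monoˡ-≤ 2 (*-monoʳ-≤ b (child-height z∈)) ⟩
      b * heightList ts + 2    ≡⟨ +-suc (b * heightList ts) 1 ⟩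
      suc (b * heightList ts + 1) ≤⟨ s≤s dense ⟩
      suc (count (node m ts))  ≤⟨ heavy ⟩
      count z + b              ≡⟨ +-comm (count z) b ⟩
      b + count z              ∎)
    where open ≤-Reasoning

  heavy-child-dense : ∀ {m ts z} → z ∈ ts → Dense (node m ts) →
    count (node m ts) < count z + b → Dense z
  heavy-child-dense {m} {z = z} z∈ dense heavy =
    ≤-trans (+-monoʳ-≤ (b * height z) (s≤s z≤n)) (heavy-child-count {m} z∈ dense heavy)

  heavy-child-not-leaf : ∀ {m ts z} → z ∈ ts → Dense (node m ts) →
    count (node m ts) < count z + b → 1 ≤ height z
  heavy-child-not-leaf {m} {z = z} z∈ dense heavy = two-marked⇒positive-height z
    (≤-trans (m≤n+m 2 (b * height z)) (heavy-child-count {m} z∈ dense heavy))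

  count-step : ∀ {i cy cz cw} → cy < cz + b → cz ≤ cw + i * b → cy ≤ cw + suc i * b
  count-step {i} {cy} {cz} {cw} heavy cz≤ = begin
    cy               ≤⟨ <⇒≤ heavy ⟩
    cz + b           ≤⟨ +-monoˡ-≤ b cz≤ ⟩
    cw + i * b + b   ≡⟨ +-assoc cw (i * b) b ⟩
    cw + (i * b + b) ≡⟨ cong (cw +_) (+-comm (i * b) b) ⟩
    cw + suc i * b   ∎
    where open ≤-Reasoning

depth-step : ∀ {i hz hy} → 1 ≤ hz → hz < hy → i ≤ hz ∸ 1 → suc i ≤ hy ∸ 1
depth-step {hy = suc hy} (s≤s z≤n) (s≤s hz≤hy) i≤ = ≤-trans (s≤s i≤) hz≤hy

descend : ∀ b n y → height y ≤ n → Dense b y → Witness b y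
descend b n y _ _ with balanced-or-heavy b y
descend b n y _ _ | inj₁ balanced = 0 , y , z≤n , here , m≤m+n (count y) 0 , balanced
descend b zero (node m ts) h≤0 _ | inj₂ (z , z∈ , _) =
  ⊥-elim (n≮0 (≤-trans (child-height z∈) h≤0))
descend b (suc n) (node m ts) h≤n dense | inj₂ (z , z∈ , heavy) =
  let (i , w , i≤ , z⇝w , count-z , balanced) =
        descend b n z (≤-pred (≤-trans (child-height z∈) h≤n))
                      (heavy-child-dense b {m} z∈ dense heavy)
  in  suc i , w , depth-step (heavy-child-not-leaf b {m} z∈ dense heavy) (child-height z∈) i≤
    , there z∈ z⇝w , count-step b {i} {cw = count w} heavy count-z , balanced

-- Lemma 4.1: the root is dense, so the descent from it yields the vertex y.
-- The argument never uses the hypothesis 1 ≤ b.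
lemma4p1 : (T : Tree) (b : ℕ) → 1 ≤ b → count T ≥ b * height T + 1 →
    Σ ℕ λ i → Σ Tree λ y → i ≤ height T ∸ 1 × Desc i T y ×
      (count T ≤ count y + i * b) ×
      (∀ z → z ∈ children y → count z + b ≤ count y)
lemma4p1 T b _ dense = descend b (height T) T ≤-refl dense
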